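{- Let $k\ge 4$ and let $G$ be a $k$-critical graph that is not isomorphic to $K_k$ and has no $(2k-1,2)$-colouring. Then $D_{k-1}(G)$ does not contain a clique on $k-1$ vertices.
   Context: A graph is $k$-critical if its chromatic number is $k$ but every proper subgraph has chromatic number at most $k-1$. For positive integers $p,q$ with $p/q\ge2$, a $(p,q)$-colouring of $G$ is a map $f:V(G)\to\{0,\dots,p-1\}$ with $q\le|f(u)-f(v)|\le p-q$ for every edge $uv$. $D_{k-1}(G)$ denotes the subgraph of $G$ induced by the vertices of degree exactly $k-1$. -}

module Defs where

open import Data.Nat.Base using (ℕ; zero; suc; _≤_; _<_; _∸_; ∣_-_∣)
open import Data.Fin.Base using (Fin)
open import Data.Bool.Base using (Bool; true; false)
open import Data.List.Base using (List; length; filterᵇ; allFin)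
open import Data.Product.Base using (Σ; _×_; ∃; ∃₂)
open import Data.Sum.Base using (_⊎_)
open import Relation.Binary.PropositionalEquality using (_≡_; _≢_)
open import Relation.Nullary using (¬_)
open import Function.Bundles using (_↔_; Inverse)
open import Function.Definitions using (Injective)

record Graph : Set where
  field
    n     : ℕ
    adj   : Fin n → Fin n → Bool
    sym   : ∀ u v → adj u v ≡ adj v u
    irrefl : ∀ v → adj v v ≡ false
open Graph public

deg : (G : Graph) → Fin (n G) → ℕ
deg G u = length (filterᵇ (adj G u) (allFin (n G)))

Colourable : Graph → ℕ → Set
Colourable G c = Σ (Fin (n G) → Fin c) λ f → ∀ u v → adj G u v ≡ true → f u ≢ f v

ChromaticNumber : Graph → ℕ → Set
ChromaticNumber G k = Colourable G k × ¬ Colourable G (k ∸ 1)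

record Subgraph (G : Graph) : Set where
  field
    vs : Fin (n G) → Bool
    es : Fin (n G) → Fin (n G) → Bool
    es-sym : ∀ u v → es u v ≡ es v u
    es-adj : ∀ u v → es u v ≡ true → adj G u v ≡ true
    es-vs  : ∀ u v → es u v ≡ true → vs u ≡ true
open Subgraph public

Proper : {G : Graph} → Subgraph G → Set
Proper {G} H = (∃ λ v → vs H v ≡ false) ⊎ (∃₂ λ u v → adj G u v ≡ true × es H u v ≡ false)

-- The subgraph H has a proper colouring with c colours (only its vertices/edges matter;
-- values on vertices outside H are irrelevant).
SubColourable : {G : Graph} → Subgraph G → ℕ → Set
SubColourable {G} H c =
  Σ (Fin (n G) → Fin c) λ f → ∀ u v → es H u v ≡ true → f u ≢ f v

Critical : ℕ → Graph → Set
Critical k G = ChromaticNumber G k × (∀ (H : Subgraph G) → Proper H → SubColourable H (k ∸ 1))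

IsoComplete : Graph → ℕ → Set
IsoComplete G k = Σ (Fin (n G) ↔ Fin k) λ φ →
  ∀ u v → (adj G u v ≡ true → Inverse.to φ u ≢ Inverse.to φ v)
        × (Inverse.to φ u ≢ Inverse.to φ v → adj G u v ≡ true)

PQColouring : Graph → ℕ → ℕ → Set
PQColouring G p q = Σ (Fin (n G) → ℕ) λ f →
  (∀ v → f v < p) ×
  (∀ u v → adj G u v ≡ true → q ≤ ∣ f u - f v ∣ × ∣ f u - f v ∣ ≤ p ∸ q)

-- D_{k-1}(G) contains a clique on m vertices: m distinct pairwise adjacent vertices,
-- each of degree exactly k-1 in G (D_{k-1}(G) is an induced subgraph).
LowVertexClique : Graph → ℕ → ℕ → Set
LowVertexClique G k m = Σ (Fin m → Fin (n G)) λ c →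
  Injective _≡_ _≡_ c ×
  (∀ i → deg G (c i) ≡ k ∸ 1) ×
  (∀ i j → i ≢ j → adj G (c i) (c j) ≡ true)

-- Each vertex of the clique Q ⊆ D_{k-1}(G) has k-2 neighbours in Q and hence exactly one
-- neighbour outside Q, its outer neighbour. If all outer neighbours coincide, Q together with
-- that vertex is a k-clique, which by criticality is all of G. Otherwise take q₁ ∈ Q with outer
-- neighbour x₁ and a (k-1)-colouring of G - q₁x₁. Then q₁ and x₁ get the same colour κ, and so
-- does the outer neighbour of every other q ∈ Q, since otherwise exchanging the colours of q₁
-- and q colours G. Permute the colours so that κ = 0 and the colour of some q whose outer
-- neighbour is not x₁ is the last one, k-2. Placing a vertex of colour r at 2r+1 if it lies in Q,
-- at 2(k-1) if it is x₁, and at 2r otherwise is then a (2k-1,2)-colouring of G.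

module Submission where

open import Defs renaming (sym to adj-sym)
open import Data.Bool.Base using (Bool; true; _∧_; not)
open import Data.Bool.Properties using (∧-comm; ∧-conicalˡ; ∧-conicalʳ; T-≡)
import Data.Bool.Properties as Bool
open import Data.Fin.Base using (Fin; zero; suc; toℕ; fromℕ; punchIn; punchOut)
open import Data.Fin.Properties
  using (_≟_; any?; all?; pigeonhole; injective⇒≤; <⇒≢; toℕ<n; toℕ-injective; toℕ-fromℕ;
         punchIn-injective; punchInᵢ≢i; punchIn-punchOut)
open import Data.Fin.Permutation.Components using (transpose; transpose-inverse)
open import Data.List.Base using (List; _∷_; lookup; filterᵇ; allFin)
open import Data.List.Membership.Propositional using (_∈_)
open import Data.List.Membership.Propositional.Properties using (∈-lookup; ∈-filter⁺; ∈-filter⁻; ∈-allFin)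
import Data.List.Relation.Unary.All as All
open import Data.List.Relation.Unary.AllPairs using (_∷_)
open import Data.List.Relation.Unary.Any using (index)
open import Data.List.Relation.Unary.Any.Properties using (lookup-index)
open import Data.List.Relation.Unary.Unique.Propositional using (Unique)
import Data.List.Relation.Unary.Unique.Propositional.Properties as Unique
open import Data.Nat.Base using (ℕ; zero; suc; _≤_; _<_; _+_; _∸_; _*_; pred; ∣_-_∣; s≤s; s≤s⁻¹; z<s)
open import Data.Nat.Properties
  using (n<1+n; n≤1+n; 1+n≰n; <⇒≱; <⇒≤; ≤∧≢⇒<; ≤-trans; <-cmp; m≤m+n; m≤n+m; *-suc; *-monoʳ-≤; +-monoˡ-<; ∣-∣-comm;
         m≤n⇒∣m-n∣≡n∸m; m+n≤o⇒m≤o∸n; m+n≤o⇒n≤o; <⇒≤pred; m+n∸m≡n; ∸-monoˡ-<)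
open import Data.Product.Base using (∃; _×_; _,_; proj₁; proj₂)
open import Data.Sum.Base using (_⊎_; inj₁; inj₂; [_,_]′)
open import Data.Vec.Functional as Vector using (_∷_)
open import Function.Base using (_∘_)
open import Function.Bundles using (Equivalence; mk⇔; mk↔ₛ′)
open import Function.Definitions using (Injective)
open import Relation.Binary.PropositionalEquality
open import Relation.Binary.Core using (Rel)
open import Relation.Binary.Definitions using (Symmetric; tri<; tri≈; tri>)
open import Relation.Unary using (Pred)
open import Relation.Nullary using (¬_; Dec; yes; no; does; contradiction)
open import Relation.Nullary.Decidable using (dec-true; dec-false; does-⇔; decidable-stable; ¬?; _×-dec_; _⊎-dec_)
open import Relation.Nullary.Decidable.Core using (T?)

lookup-injective : ∀ {A : Set} {xs : List A} → Unique xs → Injective _≡_ _≡_ (lookup xs)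
lookup-injective {xs = _ ∷ _} (_ ∷ _) {zero} {zero} _ = refl
lookup-injective {xs = _ ∷ xs} (x∉ ∷ _) {zero} {suc j} eq = contradiction eq (All.lookup x∉ (∈-lookup {xs = xs} j))
lookup-injective {xs = _ ∷ xs} (x∉ ∷ _) {suc i} {zero} eq = contradiction (sym eq) (All.lookup x∉ (∈-lookup {xs = xs} i))
lookup-injective {xs = _ ∷ _} (_ ∷ unique) {suc i} {suc j} eq = cong suc (lookup-injective unique eq)

∷-injective : ∀ {A : Set} {m} {a : A} {h : Fin m → A} →
              (∀ t → h t ≢ a) → Injective _≡_ _≡_ h → Injective _≡_ _≡_ (a Vector.∷ h)
∷-injective a∉h h-inj {zero} {zero} _ = refl
∷-injective a∉h h-inj {zero} {suc t} eq = contradiction (sym eq) (a∉h t)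
∷-injective a∉h h-inj {suc t} {zero} eq = contradiction eq (a∉h t)
∷-injective a∉h h-inj {suc s} {suc t} eq = cong suc (h-inj eq)

Vertex : Graph → Set
Vertex G = Fin (n G)

Adjacent : (G : Graph) → Vertex G → Vertex G → Set
Adjacent G u v = adj G u v ≡ true

IsClique : {m : ℕ} (G : Graph) → (Fin m → Vertex G) → Set
IsClique G c = ∀ i j → i ≢ j → Adjacent G (c i) (c j)

IsColouring : {A : Set} (G : Graph) → (Vertex G → A) → Set
IsColouring G f = ∀ u v → Adjacent G u v → f u ≢ f v

IsSubColouring : {A : Set} {G : Graph} → Subgraph G → (Vertex G → A) → Set
IsSubColouring H f = ∀ u v → es H u v ≡ true → f u ≢ f v

module _ (G : Graph) where

  Adjacent-sym : ∀ {u v} → Adjacent G u v → Adjacent G v u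
  Adjacent-sym {u} {v} e = trans (adj-sym G v u) e

  Adjacent-irrefl : ∀ {v} → ¬ Adjacent G v v
  Adjacent-irrefl {v} e with trans (sym e) (irrefl G v)
  ... | ()

  clique-injective : ∀ {m} {c : Fin m → Vertex G} → IsClique G c → Injective _≡_ _≡_ c
  clique-injective {c = c} c-clique {i} {j} ci≡cj with i ≟ j
  ... | yes i≡j = i≡j
  ... | no i≢j = contradiction (subst (Adjacent G (c i)) (sym ci≡cj) (c-clique i j i≢j)) Adjacent-irrefl

  neighbours : Vertex G → List (Vertex G)
  neighbours u = filterᵇ (adj G u) (allFin (n G))

  ∈-neighbours⁺ : ∀ {u v} → Adjacent G u v → v ∈ neighbours u
  ∈-neighbours⁺ {u} {v} e = ∈-filter⁺ (T? ∘ adj G u) (∈-allFin v) (Equivalence.from T-≡ e)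

  ∈-neighbours⁻ : ∀ {u v} → v ∈ neighbours u → Adjacent G u v
  ∈-neighbours⁻ {u} v∈ = Equivalence.to T-≡ (proj₂ (∈-filter⁻ (T? ∘ adj G u) {xs = allFin (n G)} v∈))

  neighbours-unique : ∀ u → Unique (neighbours u)
  neighbours-unique u = Unique.filter⁺ (T? ∘ adj G u) (Unique.allFin⁺ (n G))

  module _ {u : Vertex G} where

    ≤-deg : ∀ {m} (h : Fin m → Vertex G) → Injective _≡_ _≡_ h → (∀ t → Adjacent G u (h t)) → m ≤ deg G u
    ≤-deg {m} h h-inj h-adj = injective⇒≤ position-injective
      where
      position : Fin m → Fin (deg G u)
      position t = index (∈-neighbours⁺ (h-adj t))
      position-injective : Injective _≡_ _≡_ position
      position-injective {s} {t} eq = h-inj (begin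
        h s                               ≡⟨ lookup-index (∈-neighbours⁺ (h-adj s)) ⟩
        lookup (neighbours u) (position s) ≡⟨ cong (lookup (neighbours u)) eq ⟩
        lookup (neighbours u) (position t) ≡⟨ lookup-index (∈-neighbours⁺ (h-adj t)) ⟨
        h t                               ∎)
        where open ≡-Reasoning

    deg-≤ : ∀ {m} (h : Fin m → Vertex G) → (∀ {v} → Adjacent G u v → ∃ λ t → h t ≡ v) → deg G u ≤ m
    deg-≤ {m} h covers = injective⇒≤ preimage-injective
      where
      preimage : Fin (deg G u) → Fin m
      preimage i = proj₁ (covers (∈-neighbours⁻ (∈-lookup i)))
      preimage-injective : Injective _≡_ _≡_ preimage
      preimage-injective {i} {j} eq = lookup-injective (neighbours-unique u) (begin
        lookup (neighbours u) i ≡⟨ proj₂ (covers (∈-neighbours⁻ (∈-lookup i))) ⟨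
        h (preimage i)          ≡⟨ cong h eq ⟩
        h (preimage j)          ≡⟨ proj₂ (covers (∈-neighbours⁻ (∈-lookup j))) ⟩
        lookup (neighbours u) j ∎)
        where open ≡-Reasoning

    neighbour-outside : ∀ {m} (h : Fin m → Vertex G) → m < deg G u → ∃ λ v → Adjacent G u v × (∀ t → h t ≢ v)
    neighbour-outside h m<deg with any? (λ v → (adj G u v Bool.≟ true) ×-dec all? (λ t → ¬? (h t ≟ v)))
    ... | yes found = found
    ... | no none = contradiction (deg-≤ h covers) (<⇒≱ m<deg)
      where
      covers : ∀ {v} → Adjacent G u v → ∃ λ t → h t ≡ v
      covers {v} e with any? (λ t → h t ≟ v)
      ... | yes hit = hit
      ... | no miss = contradiction (v , e , λ t eq → miss (t , eq)) none

    neighbour-inside : ∀ {m} (h : Fin m → Vertex G) → Injective _≡_ _≡_ h → (∀ t → Adjacent G u (h t)) →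
                       deg G u ≡ m → ∀ {v} → Adjacent G u v → ∃ λ t → h t ≡ v
    neighbour-inside {m} h h-inj h-adj deg≡m {v} e with any? (λ t → h t ≟ v)
    ... | yes hit = hit
    ... | no miss = contradiction (subst (suc m ≤_) deg≡m suc-m≤deg) 1+n≰n
      where
      extended-adj : ∀ t → Adjacent G u ((v Vector.∷ h) t)
      extended-adj zero = e
      extended-adj (suc t) = h-adj t
      suc-m≤deg : suc m ≤ deg G u
      suc-m≤deg = ≤-deg (v Vector.∷ h) (∷-injective (λ t eq → miss (t , eq)) h-inj) extended-adj

  deleteVertex : Vertex G → Subgraph G
  deleteVertex w = record
    { vs = kept
    ; es = λ u v → adj G u v ∧ (kept u ∧ kept v)
    ; es-sym = λ u v → cong₂ _∧_ (adj-sym G u v) (∧-comm (kept u) (kept v))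
    ; es-adj = λ u v → ∧-conicalˡ _ _
    ; es-vs = λ u v e → ∧-conicalˡ (kept u) (kept v) (∧-conicalʳ (adj G u v) _ e)
    }
    where
    kept : Vertex G → Bool
    kept u = not (does (u ≟ w))

  deleteVertex-proper : ∀ w → Proper (deleteVertex w)
  deleteVertex-proper w = inj₁ (w , cong not (dec-true (w ≟ w) refl))

  deleteVertex-edge : ∀ {w u v} → Adjacent G u v → u ≢ w → v ≢ w → es (deleteVertex w) u v ≡ true
  deleteVertex-edge {w} {u} {v} e u≢w v≢w =
    cong₂ _∧_ e (cong₂ _∧_ (cong not (dec-false (u ≟ w) u≢w)) (cong not (dec-false (v ≟ w) v≢w)))

  Joins : Vertex G → Vertex G → Vertex G → Vertex G → Set
  Joins u w a b = (a ≡ u × b ≡ w) ⊎ (a ≡ w × b ≡ u)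

  joins? : ∀ u w a b → Dec (Joins u w a b)
  joins? u w a b = ((a ≟ u) ×-dec (b ≟ w)) ⊎-dec ((a ≟ w) ×-dec (b ≟ u))

  Joins-swap : ∀ {u w a b} → Joins u w a b → Joins u w b a
  Joins-swap (inj₁ (a≡u , b≡w)) = inj₂ (b≡w , a≡u)
  Joins-swap (inj₂ (a≡w , b≡u)) = inj₁ (b≡u , a≡w)

  joins?-sym : ∀ u w a b → does (joins? u w a b) ≡ does (joins? u w b a)
  joins?-sym u w a b = does-⇔ (mk⇔ Joins-swap Joins-swap) (joins? u w a b) (joins? u w b a)

  deleteEdge : Vertex G → Vertex G → Subgraph G
  deleteEdge u w = record
    { vs = λ _ → true
    ; es = λ a b → adj G a b ∧ not (does (joins? u w a b))
    ; es-sym = λ a b → cong₂ (λ x y → x ∧ not y) (adj-sym G a b) (joins?-sym u w a b)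
    ; es-adj = λ a b → ∧-conicalˡ _ _
    ; es-vs = λ _ _ _ → refl
    }

  deleteEdge-proper : ∀ {u w} → Adjacent G u w → Proper (deleteEdge u w)
  deleteEdge-proper {u} {w} e =
    inj₂ (u , w , e , cong₂ (λ x y → x ∧ not y) e (dec-true (joins? u w u w) (inj₁ (refl , refl))))

  deleteEdge-edge : ∀ {u w a b} → Adjacent G a b → ¬ Joins u w a b → es (deleteEdge u w) a b ≡ true
  deleteEdge-edge {u} {w} {a} {b} e ¬joins = cong₂ (λ x y → x ∧ not y) e (dec-false (joins? u w a b) ¬joins)

  deleteEdge-colouring : ∀ {A : Set} {u w} {f : Vertex G → A} →
                         IsSubColouring (deleteEdge u w) f → f u ≢ f w → IsColouring G f
  deleteEdge-colouring {u = u} {w} f-colours fu≢fw a b e with joins? u w a b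
  ... | yes (inj₁ (refl , refl)) = fu≢fw
  ... | yes (inj₂ (refl , refl)) = fu≢fw ∘ sym
  ... | no ¬joins = f-colours a b (deleteEdge-edge e ¬joins)

critical-clique-surjective : ∀ {k} (G : Graph) → Critical (suc k) G →
                             (d : Fin (suc k) → Vertex G) → IsClique G d → ∀ v → ∃ λ i → d i ≡ v
critical-clique-surjective {k} G (_ , subgraphs-colourable) d d-clique v with any? (λ i → d i ≟ v)
... | yes hit = hit
... | no miss with subgraphs-colourable (deleteVertex G v) (deleteVertex-proper G v)
... | f , f-colours with pigeonhole (n<1+n k) (f ∘ d)
... | i , j , i<j , same-colour = contradiction same-colour (f-colours (d i) (d j) edge)
  where
  edge : es (deleteVertex G v) (d i) (d j) ≡ true
  edge = deleteVertex-edge G (d-clique i j (<⇒≢ i<j)) (miss ∘ (i ,_)) (miss ∘ (j ,_))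

spanning-clique⇒IsoComplete : ∀ {k} (G : Graph) (d : Fin k → Vertex G) → IsClique G d →
                              (∀ v → ∃ λ i → d i ≡ v) → IsoComplete G k
spanning-clique⇒IsoComplete {k} G d d-clique d-onto = mk↔ₛ′ d⁻¹ d d⁻¹∘d d∘d⁻¹ , adjacency
  where
  d⁻¹ : Vertex G → Fin k
  d⁻¹ v = proj₁ (d-onto v)
  d∘d⁻¹ : ∀ v → d (d⁻¹ v) ≡ v
  d∘d⁻¹ v = proj₂ (d-onto v)
  d⁻¹∘d : ∀ i → d⁻¹ (d i) ≡ i
  d⁻¹∘d i = clique-injective G d-clique (d∘d⁻¹ (d i))
  adjacency : ∀ u v → (Adjacent G u v → d⁻¹ u ≢ d⁻¹ v) × (d⁻¹ u ≢ d⁻¹ v → Adjacent G u v)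
  adjacency u v =
    (λ e same → Adjacent-irrefl G (subst (Adjacent G u) (trans (sym (d∘d⁻¹ v)) (trans (cong d (sym same)) (d∘d⁻¹ u))) e))
    ,
    (λ distinct → subst₂ (Adjacent G) (d∘d⁻¹ u) (d∘d⁻¹ v) (d-clique _ _ distinct))

module _ {m : ℕ} where

  transpose-matchˡ : ∀ (i j : Fin m) → transpose i j i ≡ j
  transpose-matchˡ i j rewrite dec-true (i ≟ i) refl = refl

  transpose-matchʳ : ∀ (i j : Fin m) → transpose i j j ≡ i
  transpose-matchʳ i j with j ≟ i
  ... | yes j≡i = j≡i
  ... | no _ rewrite dec-true (j ≟ j) refl = refl

  transpose-other : ∀ {i j k : Fin m} → k ≢ i → k ≢ j → transpose i j k ≡ k
  transpose-other {i} {j} {k} k≢i k≢j rewrite dec-false (k ≟ i) k≢i | dec-false (k ≟ j) k≢j = refl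

  transpose-injective : ∀ (i j : Fin m) → Injective _≡_ _≡_ (transpose i j)
  transpose-injective i j {a} {b} eq = begin
    a                                 ≡⟨ transpose-inverse j i ⟨
    transpose j i (transpose i j a) ≡⟨ cong (transpose j i) eq ⟩
    transpose j i (transpose i j b) ≡⟨ transpose-inverse j i ⟩
    b                                 ∎
    where open ≡-Reasoning

  ∃-injection-sending : ∀ {a b a′ b′ : Fin m} → a ≢ b → a′ ≢ b′ →
                        ∃ λ (π : Fin m → Fin m) → Injective _≡_ _≡_ π × π a ≡ a′ × π b ≡ b′
  ∃-injection-sending {a} {b} {a′} {b′} a≢b a′≢b′ =
    transpose b₁ b′ ∘ transpose a a′ ,
    transpose-injective a a′ ∘ transpose-injective b₁ b′ ,
    trans (cong (transpose b₁ b′) (transpose-matchˡ a a′)) (transpose-other a′≢b₁ a′≢b′) ,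
    transpose-matchˡ b₁ b′
    where
    b₁ : Fin m
    b₁ = transpose a a′ b
    a′≢b₁ : a′ ≢ b₁
    a′≢b₁ eq = a≢b (transpose-injective a a′ (trans (transpose-matchˡ a a′) eq))

0<toℕ : ∀ {m} {a : Fin (suc m)} → a ≢ zero → 0 < toℕ a
0<toℕ {a = zero} a≢0 = contradiction refl a≢0
0<toℕ {a = suc _} _ = z<s

toℕ<-of-≢fromℕ : ∀ {m} {a : Fin (suc m)} → a ≢ fromℕ m → toℕ a < m
toℕ<-of-≢fromℕ {m} {a} a≢last =
  ≤∧≢⇒< (s≤s⁻¹ (toℕ<n a)) (λ eq → a≢last (toℕ-injective (trans eq (sym (toℕ-fromℕ m)))))

distinct⇒zero≢fromℕ : ∀ {m} {a b : Fin (suc m)} → a ≢ b → zero ≢ fromℕ m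
distinct⇒zero≢fromℕ {zero} {zero} {zero} a≢b _ = a≢b refl
distinct⇒zero≢fromℕ {suc m} _ ()

Distant : ℕ → ℕ → ℕ → Set
Distant p a b = 2 ≤ ∣ a - b ∣ × ∣ a - b ∣ ≤ p ∸ 2

Distant-sym : ∀ {p} → Symmetric (Distant p)
Distant-sym {p} {a} {b} = subst (λ d → 2 ≤ d × d ≤ p ∸ 2) (∣-∣-comm a b)

2*-mono-< : ∀ {t t′} → t < t′ → 2 + 2 * t ≤ 2 * t′
2*-mono-< {t} {t′} t<t′ = subst (_≤ 2 * t′) (*-suc 2 t) (*-monoʳ-≤ 2 t<t′)

0<2* : ∀ {t} → 0 < t → 0 < 2 * t
0<2* {t} 0<t = ≤-trans 0<t (m≤m+n t (t + 0))

module _ {m : ℕ} where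

  distant : ∀ {a b} → 2 + a ≤ b → b < a + 2 * m → Distant (suc (2 * m)) a b
  distant {a} {b} 2+a≤b b<a+2m = subst (λ d → 2 ≤ d × d ≤ pred (2 * m)) (sym (m≤n⇒∣m-n∣≡n∸m a≤b))
    (m+n≤o⇒m≤o∸n 2 2+a≤b , <⇒≤pred (subst (b ∸ a <_) (m+n∸m≡n a (2 * m)) (∸-monoˡ-< b<a+2m a≤b)))
    where
    a≤b : a ≤ b
    a≤b = m+n≤o⇒n≤o 2 2+a≤b

  distant-< : ∀ {t t′} → t < t′ → t′ < m → Distant (suc (2 * m)) (2 * t) (2 * t′)
  distant-< {t} {t′} t<t′ t′<m =
    distant (2*-mono-< t<t′) (≤-trans (n≤1+n _) (≤-trans (2*-mono-< t′<m) (m≤n+m (2 * m) (2 * t))))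

  distant-≢ : ∀ {t t′} → t ≢ t′ → t < m → t′ < m → Distant (suc (2 * m)) (2 * t) (2 * t′)
  distant-≢ {t} {t′} t≢t′ t<m t′<m with <-cmp t t′
  ... | tri< t<t′ _ _ = distant-< t<t′ t′<m
  ... | tri≈ _ t≡t′ _ = contradiction t≡t′ t≢t′
  ... | tri> _ _ t′<t = Distant-sym {suc (2 * m)} {2 * t′} {2 * t} (distant-< t′<t t<m)

  distant-even-top : ∀ {t} → 0 < t → t < m → Distant (suc (2 * m)) (2 * t) (2 * m)
  distant-even-top {t} 0<t t<m = distant (2*-mono-< t<m) (+-monoˡ-< (2 * m) (0<2* 0<t))

  distant-odd-top : ∀ {t} → suc t < m → Distant (suc (2 * m)) (suc (2 * t)) (2 * m)
  distant-odd-top {t} 1+t<m =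
    distant (≤-trans (n≤1+n _) (subst (λ x → 2 + x ≤ 2 * m) (*-suc 2 t) (2*-mono-< 1+t<m)))
            (s≤s (m≤n+m (2 * m) (2 * t)))

  distant-zero-odd : ∀ {t} → 0 < t → t < m → Distant (suc (2 * m)) 0 (suc (2 * t))
  distant-zero-odd 0<t t<m = distant (s≤s (0<2* 0<t)) (2*-mono-< t<m)

module LowClique {G : Graph} {s : ℕ} (c : Fin (suc s) → Vertex G)
                 (c-deg : ∀ i → deg G (c i) ≡ suc s) (c-clique : IsClique G c) where

  InClique : Vertex G → Set
  InClique v = ∃ λ i → c i ≡ v

  inClique? : ∀ v → Dec (InClique v)
  inClique? v = any? (λ i → c i ≟ v)

  others : Fin (suc s) → Fin s → Vertex G
  others i = c ∘ punchIn i

  others-adjacent : ∀ i t → Adjacent G (c i) (others i t)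
  others-adjacent i t = c-clique i (punchIn i t) (punchInᵢ≢i i t ∘ sym)

  others-injective : ∀ i → Injective _≡_ _≡_ (others i)
  others-injective i = punchIn-injective i _ _ ∘ clique-injective G c-clique

  outer-neighbour : ∀ i → ∃ λ v → Adjacent G (c i) v × (∀ t → others i t ≢ v)
  outer-neighbour i = neighbour-outside G (others i) (subst (s <_) (sym (c-deg i)) (n<1+n s))

  outer : Fin (suc s) → Vertex G
  outer i = proj₁ (outer-neighbour i)

  outer-adjacent : ∀ i → Adjacent G (c i) (outer i)
  outer-adjacent i = proj₁ (proj₂ (outer-neighbour i))

  outer-outside : ∀ i → ¬ InClique (outer i)
  outer-outside i (j , cj≡outer) with j ≟ i
  ... | yes refl = Adjacent-irrefl G (subst (Adjacent G (c i)) (sym cj≡outer) (outer-adjacent i))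
  ... | no j≢i = proj₂ (proj₂ (outer-neighbour i)) (punchOut (j≢i ∘ sym))
                   (trans (cong c (punchIn-punchOut (j≢i ∘ sym))) cj≡outer)

  outer∷others-adjacent : ∀ i t → Adjacent G (c i) ((outer i Vector.∷ others i) t)
  outer∷others-adjacent i zero = outer-adjacent i
  outer∷others-adjacent i (suc t) = others-adjacent i t

  outer-unique : ∀ {i v} → Adjacent G (c i) v → ¬ InClique v → v ≡ outer i
  outer-unique {i} e v∉ with neighbour-inside G (outer i Vector.∷ others i)
                               (∷-injective (λ t eq → outer-outside i (punchIn i t , eq)) (others-injective i))
                               (outer∷others-adjacent i) (c-deg i) e
  ... | zero , outer≡v = sym outer≡v
  ... | suc t , others≡v = contradiction (punchIn i t , others≡v) v∉

  glue : {A : Set} → (Fin (suc s) → A) → (Vertex G → A) → Vertex G → A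
  glue φ ψ v with inClique? v
  ... | yes (i , _) = φ i
  ... | no _ = ψ v

  glue-respects : ∀ {A : Set} {ℓ} (R : Rel A ℓ) {φ : Fin (suc s) → A} {ψ : Vertex G → A} → Symmetric R →
                  (∀ i j → i ≢ j → R (φ i) (φ j)) → (∀ i → R (φ i) (ψ (outer i))) →
                  (∀ u v → Adjacent G u v → ¬ InClique u → ¬ InClique v → R (ψ u) (ψ v)) →
                  ∀ u v → Adjacent G u v → R (glue φ ψ u) (glue φ ψ v)
  glue-respects R {φ} {ψ} R-sym inside across outside u v e with inClique? u | inClique? v
  ... | yes (i , refl) | yes (j , refl) = inside i j (λ { refl → Adjacent-irrefl G e })
  ... | yes (i , refl) | no v∉ = subst (R (φ i) ∘ ψ) (sym (outer-unique e v∉)) (across i)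
  ... | no u∉ | yes (j , refl) = R-sym (subst (R (φ j) ∘ ψ) (sym (outer-unique (Adjacent-sym G e) u∉)) (across j))
  ... | no u∉ | no v∉ = outside u v e u∉ v∉

  glue-all : ∀ {A : Set} {ℓ} {P : Pred A ℓ} {φ : Fin (suc s) → A} {ψ : Vertex G → A} →
             (∀ i → P (φ i)) → (∀ v → P (ψ v)) → ∀ v → P (glue φ ψ v)
  glue-all Pφ Pψ v with inClique? v
  ... | yes (i , _) = Pφ i
  ... | no _ = Pψ v

  outer-constant⇒IsoComplete : Critical (suc (suc s)) G → (∀ i → outer i ≡ outer zero) →
                               IsoComplete G (suc (suc s))
  outer-constant⇒IsoComplete crit constant =
    spanning-clique⇒IsoComplete G K K-clique (critical-clique-surjective G crit K K-clique)
    where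
    K : Fin (suc (suc s)) → Vertex G
    K = outer zero Vector.∷ c
    adjacent-outer-zero : ∀ i → Adjacent G (c i) (outer zero)
    adjacent-outer-zero i = subst (Adjacent G (c i)) (constant i) (outer-adjacent i)
    K-clique : IsClique G K
    K-clique zero zero 0≢0 = contradiction refl 0≢0
    K-clique zero (suc j) _ = Adjacent-sym G (adjacent-outer-zero j)
    K-clique (suc i) zero _ = adjacent-outer-zero i
    K-clique (suc i) (suc j) i≢j = c-clique i j (i≢j ∘ cong suc)

  module DistinctOuter (crit : Critical (suc (suc s)) G) {j} (outer-j≢outer-0 : outer j ≢ outer zero) where

    q₁ x₁ : Vertex G
    q₁ = c zero
    x₁ = outer zero

    H : Subgraph G
    H = deleteEdge G q₁ x₁

    G-uncolourable : ¬ Colourable G (suc s)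
    G-uncolourable = proj₂ (proj₁ crit)

    H-colouring : SubColourable H (suc s)
    H-colouring = proj₂ crit H (deleteEdge-proper G (outer-adjacent zero))

    outside≢q₁ : ∀ {v} → ¬ InClique v → v ≢ q₁
    outside≢q₁ v∉ v≡q₁ = v∉ (zero , sym v≡q₁)

    H-edge : ∀ {a b} → Adjacent G a b → a ≢ q₁ → b ≢ q₁ → es H a b ≡ true
    H-edge e a≢q₁ b≢q₁ = deleteEdge-edge G e λ
      { (inj₁ (a≡q₁ , _)) → a≢q₁ a≡q₁
      ; (inj₂ (_ , b≡q₁)) → b≢q₁ b≡q₁ }

    j≢zero : j ≢ zero
    j≢zero refl = outer-j≢outer-0 refl

    module _ {f : Vertex G → Fin (suc s)} (f-colours-H : IsSubColouring H f) where

      clique-rainbow : ∀ {i i′} → i ≢ i′ → f (c i) ≢ f (c i′)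
      clique-rainbow {i} {i′} i≢i′ = f-colours-H (c i) (c i′) (deleteEdge-edge G (c-clique i i′ i≢i′) λ
        { (inj₁ (_ , ci′≡x₁)) → outer-outside zero (i′ , ci′≡x₁)
        ; (inj₂ (ci≡x₁ , _)) → outer-outside zero (i , ci≡x₁) })

      q₁-x₁-same-colour : f q₁ ≡ f x₁
      q₁-x₁-same-colour with f q₁ ≟ f x₁
      ... | yes same = same
      ... | no differ = contradiction (f , deleteEdge-colouring G f-colours-H differ) G-uncolourable

      outer-coloured-like-q₁ : ∀ {i} → i ≢ zero → f (outer i) ≡ f q₁
      outer-coloured-like-q₁ {i} i≢0 with f (outer i) ≟ f q₁
      ... | yes same = same
      ... | no differ = contradiction (exchanged , exchanged-colours-G) G-uncolourable
        where
        σ : Fin (suc s) → Fin (suc s)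
        σ = transpose zero i
        across-by-cases : ∀ a → Dec (a ≡ zero) → Dec (a ≡ i) → f (c (σ a)) ≢ f (outer a)
        across-by-cases _ (yes refl) _ eq = clique-rainbow i≢0
          (trans (cong (f ∘ c) (sym (transpose-matchˡ zero i))) (trans eq (sym q₁-x₁-same-colour)))
        across-by-cases _ (no _) (yes refl) eq = differ (sym (trans (cong (f ∘ c) (sym (transpose-matchʳ zero i))) eq))
        across-by-cases a (no a≢0) (no a≢i) = subst (λ b → f (c b) ≢ f (outer a)) (sym (transpose-other a≢0 a≢i))
          (f-colours-H (c a) (outer a)
            (H-edge (outer-adjacent a) (a≢0 ∘ clique-injective G c-clique) (outside≢q₁ (outer-outside a))))
        across : ∀ a → f (c (σ a)) ≢ f (outer a)
        across a = across-by-cases a (a ≟ zero) (a ≟ i)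
        exchanged : Vertex G → Fin (suc s)
        exchanged = glue (f ∘ c ∘ σ) f
        exchanged-colours-G : IsColouring G exchanged
        exchanged-colours-G = glue-respects _≢_ ≢-sym
          (λ a b a≢b → clique-rainbow (a≢b ∘ transpose-injective zero i)) across
          (λ u v e u∉ v∉ → f-colours-H u v (H-edge e (outside≢q₁ u∉) (outside≢q₁ v∉)))

    module Positions {g : Vertex G → Fin (suc s)} (g-colours-H : IsSubColouring H g)
                     (g-q₁ : g q₁ ≡ zero) (g-cj : g (c j) ≡ fromℕ s) where

      p : ℕ
      p = suc (2 * suc s)

      rank : Vertex G → ℕ
      rank v = toℕ (g v)

      outside-position : Vertex G → ℕ
      outside-position v with v ≟ x₁
      ... | yes _ = 2 * suc s
      ... | no _ = 2 * rank v

      position : Vertex G → ℕ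
      position = glue (λ i → suc (2 * rank (c i))) outside-position

      position-< : ∀ v → position v < p
      position-< = glue-all {P = _< p} (λ i → s≤s (≤-trans (n≤1+n _) (2*-mono-< (toℕ<n (g (c i)))))) outside-<
        where
        outside-< : ∀ v → outside-position v < p
        outside-< v with v ≟ x₁
        ... | yes _ = n<1+n _
        ... | no _ = s≤s (*-monoʳ-≤ 2 (<⇒≤ (toℕ<n (g v))))

      x₁-coloured-zero : g x₁ ≡ zero
      x₁-coloured-zero = trans (sym (q₁-x₁-same-colour g-colours-H)) g-q₁

      rank-positive-near-x₁ : ∀ {v} → Adjacent G x₁ v → ¬ InClique v → 0 < rank v
      rank-positive-near-x₁ e v∉ = 0<toℕ λ gv≡0 → g-colours-H _ _
        (H-edge e (outside≢q₁ (outer-outside zero)) (outside≢q₁ v∉)) (trans x₁-coloured-zero (sym gv≡0))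

      inside : ∀ i i′ → i ≢ i′ → Distant p (suc (2 * rank (c i))) (suc (2 * rank (c i′)))
      inside i i′ i≢i′ = distant-≢ (clique-rainbow g-colours-H i≢i′ ∘ toℕ-injective) (toℕ<n _) (toℕ<n _)

      across : ∀ i → Distant p (suc (2 * rank (c i))) (outside-position (outer i))
      across i with outer i ≟ x₁
      ... | yes outer≡x₁ =
          distant-odd-top (s≤s (toℕ<-of-≢fromℕ λ eq → clique-rainbow g-colours-H i≢j (trans eq (sym g-cj))))
        where
        i≢j : i ≢ j
        i≢j refl = outer-j≢outer-0 outer≡x₁
      ... | no outer≢x₁ = Distant-sym {p} {2 * rank (outer i)}
          (subst (λ r → Distant p (2 * r) (suc (2 * rank (c i)))) (sym rank-outer≡0)
            (distant-zero-odd (0<toℕ λ eq → clique-rainbow g-colours-H i≢0 (trans eq (sym g-q₁))) (toℕ<n _)))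
        where
        i≢0 : i ≢ zero
        i≢0 refl = outer≢x₁ refl
        rank-outer≡0 : rank (outer i) ≡ 0
        rank-outer≡0 = cong toℕ (trans (outer-coloured-like-q₁ g-colours-H i≢0) g-q₁)

      outside : ∀ u v → Adjacent G u v → ¬ InClique u → ¬ InClique v →
                Distant p (outside-position u) (outside-position v)
      outside u v e u∉ v∉ with u ≟ x₁ | v ≟ x₁
      ... | yes refl | yes refl = contradiction e (Adjacent-irrefl G)
      ... | yes refl | no _ = Distant-sym {p} {2 * rank v}
                                (distant-even-top (rank-positive-near-x₁ e v∉) (toℕ<n _))
      ... | no _ | yes refl = distant-even-top (rank-positive-near-x₁ (Adjacent-sym G e) u∉) (toℕ<n _)
      ... | no _ | no _ = distant-≢ (g-colours-H u v (H-edge e (outside≢q₁ u∉) (outside≢q₁ v∉)) ∘ toℕ-injective)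
                            (toℕ<n _) (toℕ<n _)

      pqColouring : PQColouring G p 2
      pqColouring = position , position-< ,
        glue-respects (Distant p) (λ {a} {b} → Distant-sym {p} {a} {b}) inside across outside

    pqColouring : PQColouring G (suc (2 * suc s)) 2
    pqColouring =
      let f , f-colours-H = H-colouring
          κ≢λ = clique-rainbow f-colours-H (j≢zero ∘ sym)
          π , π-injective , π-q₁ , π-cj = ∃-injection-sending κ≢λ (distinct⇒zero≢fromℕ κ≢λ)
      in Positions.pqColouring {π ∘ f} (λ u v e → f-colours-H u v e ∘ π-injective) π-q₁ π-cj

  complete⊎pqColouring : Critical (suc (suc s)) G → IsoComplete G (suc (suc s)) ⊎ PQColouring G (suc (2 * suc s)) 2
  complete⊎pqColouring crit with any? (λ i → ¬? (outer i ≟ outer zero))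
  ... | yes (_ , differ) = inj₂ (DistinctOuter.pqColouring crit differ)
  ... | no constant = inj₁ (outer-constant⇒IsoComplete crit λ i →
                        decidable-stable (outer i ≟ outer zero) (constant ∘ (i ,_)))

theorem1p15 : (k : ℕ) → 4 ≤ k → (G : Graph) → Critical k G → ¬ IsoComplete G k →
    ¬ PQColouring G (2 * k ∸ 1) 2 → ¬ LowVertexClique G k (k ∸ 1)
theorem1p15 (suc (suc s)) (s≤s (s≤s _)) G crit not-complete no-colouring (c , _ , c-deg , c-clique) =
  [ not-complete , no-colouring ∘ subst (λ p → PQColouring G p 2) (cong (_∸ 1) (sym (*-suc 2 (suc s)))) ]′
    (LowClique.complete⊎pqColouring c c-deg c-clique crit)
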